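{- Let $\vec{a}=(a_1,\dots,a_n)$ be a non-decreasing sequence of positive integers. If $a_1$ is even, then every $H\in\mathcal{H}_{\vec{a}}$ has at least one moveable cell. If $a_1$ is odd, then the elements $H\in\mathcal{H}_{\vec{a}}$ having no moveable cell are exactly those in which, for every $i\in[n]$, the cell $\sigma_i$ is the bottom cell of column $i$, and the permutation $\sigma_n\sigma_{n-1}\cdots\sigma_2\sigma_1$ has descent set $S=\{i\in[n-1]: a_{i+1}\text{ is odd}\}$.
   Context: $Y_{\vec{a}}$ is the Young diagram with columns numbered $1,\dots,n$ from left to right and rows numbered from top to bottom, where column $c$ consists of the cells in rows $1,\dots,a_{n+1-c}$. A horizontal strip $H$ in $Y_{\vec{a}}$ is a set of cells of $Y_{\vec{a}}$ containing exactly one cell $\sigma_i$ in each column $i\in[n]$, such that for $i<j$ the cell $\sigma_i$ is in the same row as or a lower row than $\sigma_j$ (i.e. $r(\sigma_i)\ge r(\sigma_j)$, where $r(\sigma)$ is the row number of $\sigma$). A proper filling of $H$ writes the numbers $1,\dots,n$ bijectively into its cells so that within each row $r$ the numbers increase from left to right if $r$ is odd and decrease from left to right if $r$ is even; $\sigma_i$ also denotes the number written in the cell in column $i$. $\mathcal{H}_{\vec{a}}$ is the set of properly filled horizontal strips in $Y_{\vec{a}}$. For $H\in\mathcal{H}_{\vec{a}}$, adjoin an imaginary cell $\sigma_{n+1}=n+1$ in row $1$, column $n+1$, and set $\epsilon_i=\operatorname{sgn}(\sigma_i-\sigma_{i+1})(-1)^{r(\sigma_i)}$ for $i\in[n]$.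 The assigned direction of $\sigma_i$ is up if $\epsilon_i=-1$ and down if $\epsilon_i=1$. $\sigma_i$ is moveable up if its assigned direction is up. $\sigma_i$ is moveable down if its assigned direction is down, $\sigma_i$ is not the bottom cell of column $i$, and moving $\sigma_i$ (with its number) to the cell immediately below it again yields an element of $\mathcal{H}_{\vec{a}}$. A cell is moveable if it is moveable up or moveable down. The descent set of a permutation $w_1\cdots w_n$ is $\{i\in[n-1]: w_i>w_{i+1}\}$. -}

module Defs where

open import Data.Nat using (ℕ; zero; suc; _≤_; _<_; _<?_; _≡ᵇ_; _<ᵇ_)
open import Data.Nat.Divisibility using (_∣_)
open import Data.Fin using (Fin; toℕ; fromℕ<; opposite; _≟_)
open import Data.Integer using (ℤ; +_; -_; _*_; _^_; 1ℤ; -1ℤ; 0ℤ)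
open import Data.Bool using (if_then_else_)
open import Data.Product using (_×_; Σ)
open import Relation.Nullary using (¬_; yes; no; does)
open import Relation.Binary.PropositionalEquality using (_≡_)
open import Function.Definitions using (Bijective)

Even : ℕ → Set
Even k = 2 ∣ k

Odd : ℕ → Set
Odd k = 2 ∣ suc k

-- 1-indexed access to a 0-indexed finite sequence, with default value d
-- outside the range 1..n.
at1 : ∀ {n} {A : Set} → (Fin n → A) → A → ℕ → A
at1 f d zero = d
at1 {n} f d (suc k) with k <? n
... | yes p = f (fromℕ< p)
... | no _ = d

-- The sequence a = (a_1,...,a_n) is given 0-indexed: a_k = a (k-1).
NonDecreasing : ∀ {n} → (Fin n → ℕ) → Set
NonDecreasing {n} a = ∀ (i j : Fin n) → toℕ i ≤ toℕ j → a i ≤ a j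

-- Columns are 0-indexed: Fin n element i is column i+1.
-- Column c (1-indexed) has height a_{n+1-c}; for the 0-indexed column i
-- this is a_{n-i} = a (opposite i).
height : ∀ {n} → (Fin n → ℕ) → Fin n → ℕ
height a i = a (opposite i)

-- A (candidate) filled horizontal strip: for each column i the row (1-indexed)
-- of its cell sigma_i and the number written in it (the number k ∈ [n]
-- is represented by the element k-1 of Fin n).
record Strip (n : ℕ) : Set where
  constructor strip
  field
    row : Fin n → ℕ
    num : Fin n → Fin n
open Strip public

record IsH {n} (a : Fin n → ℕ) (H : Strip n) : Set where
  field
    inDiagram  : ∀ i → 1 ≤ row H i × row H i ≤ height a i
    horizontal : ∀ (i j : Fin n) → toℕ i < toℕ j → row H j ≤ row H i
    bijective  : Bijective _≡_ _≡_ (num H)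
    proper     : ∀ (i j : Fin n) → toℕ i < toℕ j → row H i ≡ row H j →
                   (Odd (row H i) → toℕ (num H i) < toℕ (num H j)) ×
                   (Even (row H i) → toℕ (num H j) < toℕ (num H i))

-- sigma_c as a number in 1..n for the 1-indexed column c ∈ [n], together with
-- the imaginary cell sigma_{n+1} = n+1.
sigHat : ∀ {n} → Strip n → ℕ → ℕ
sigHat {n} H c = if c ≡ᵇ suc n then suc n else at1 (λ i → suc (toℕ (num H i))) 0 c

sgnDiff : ℕ → ℕ → ℤ
sgnDiff x y = if y <ᵇ x then 1ℤ else (if x <ᵇ y then -1ℤ else 0ℤ)

-- epsilon_i = sgn(sigma_i - sigma_{i+1}) (-1)^{r(sigma_i)}, for the 0-indexed column i
-- (i.e. 1-indexed column i+1).
epsilon : ∀ {n} → Strip n → Fin n → ℤ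
epsilon H i = sgnDiff (sigHat H (suc (toℕ i))) (sigHat H (suc (suc (toℕ i)))) * (-1ℤ ^ row H i)

DirUp : ∀ {n} → Strip n → Fin n → Set
DirUp H i = epsilon H i ≡ -1ℤ

DirDown : ∀ {n} → Strip n → Fin n → Set
DirDown H i = epsilon H i ≡ 1ℤ

moveDown : ∀ {n} → Strip n → Fin n → Strip n
moveDown H i = strip (λ j → if does (j ≟ i) then suc (row H i) else row H j) (num H)

IsBottom : ∀ {n} → (Fin n → ℕ) → Strip n → Fin n → Set
IsBottom a H i = row H i ≡ height a i

MoveableUp : ∀ {n} → (Fin n → ℕ) → Strip n → Fin n → Set
MoveableUp a H i = DirUp H i

MoveableDown : ∀ {n} → (Fin n → ℕ) → Strip n → Fin n → Set
MoveableDown a H i = DirDown H i × ¬ IsBottom a H i × IsH a (moveDown H i)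

data Moveable {n} (a : Fin n → ℕ) (H : Strip n) (i : Fin n) : Set where
  up   : MoveableUp a H i → Moveable a H i
  down : MoveableDown a H i → Moveable a H i

DescentSet : ℕ → (ℕ → ℕ) → ℕ → Set
DescentSet n w k = 1 ≤ k × k < n × w (suc k) < w k

-- The word sigma_n sigma_{n-1} ... sigma_1 (1-indexed): w_k = sigma_{n+1-k}.
revWord : ∀ {n} → Strip n → ℕ → ℕ
revWord {n} H k = sigHat H (suc n Data.Nat.∸ k)

OddSet : ∀ {n} → (Fin n → ℕ) → ℕ → Set
OddSet {n} a k = 1 ≤ k × k < n × Odd (at1 a 0 (suc k))

module Submission where

-- Call σ_i "pointing down" when the step σ_i → σ_{i+1} runs in the order of
-- σ_i's row (increasing in odd rows, decreasing in even rows); as the entries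
-- are distinct, this is exactly ε_i = 1, and otherwise ε_i = -1, so a cell
-- that does not point down is moveable up.  If every cell points down but
-- some σ_i has room below it, walk left along σ_i's row to its leftmost cell
-- σ_j: columns only get taller to the left, so σ_j has room too, and every
-- cell left of σ_j lies strictly lower, those just one row lower preceding
-- σ_j in their row's order (they point down); hence σ_j is moveable down.
-- So H has no moveable cell iff it is "stuck": every cell is a bottom cell
-- and points down.  For a stuck strip the last cell, compared with the
-- imaginary σ_{n+1} = n+1, forces its row a_1 to be odd; and for the other
-- columns, read through the reversal k ↦ n+1-k, pointing down says exactly
-- that the descents of σ_n ⋯ σ_1 sit at the positions k with a_{k+1} odd.

open import Defs
open import Data.Nat using (ℕ; suc; _≤_)
open import Data.Fin using (Fin; zero)
open import Data.Product using (_×_; ∃)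
open import Relation.Nullary using (¬_)
open import Relation.Binary.PropositionalEquality using (_≡_)
open import Function.Bundles using (_⇔_)

open import Data.Bool using (true; false; T)
open import Data.Bool.Properties using (T-≡; ¬-not)
open import Data.Empty using (⊥-elim)
open import Data.Fin using (toℕ; fromℕ; fromℕ<; opposite; _≟_)
open import Data.Fin.Properties
  using (toℕ-injective; toℕ<n; toℕ-fromℕ; toℕ-fromℕ<; fromℕ<-toℕ; opposite-prop; all?; ¬∀⟶∃¬)
open import Data.Integer using (1ℤ; -1ℤ; _*_; _^_)
import Data.Nat as N
open import Data.Nat using (zero; _<_; _∸_; _<?_; z≤n; s≤s; s<s; s<s⁻¹)
open import Data.Nat.Divisibility using (_∣_; _∣?_; divides; ∣-refl; ∣1⇒≡1; ∣m∣n⇒∣m+n; ∣m+n∣m⇒∣n)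
open import Data.Nat.Properties
  using ( suc-injective; +-comm; <-cmp; <-asym; <-irrefl; <-trans; <-≤-trans; ≤-<-trans
        ; ≤-refl; ≤-trans; ≤-antisym; ≤-pred; n≤1+n; n<1+n; n≮0; ≮⇒≥; <⇒≤; <⇒≢; ≤∧≢⇒<
        ; m≤n⇒m<n∨m≡n; n∸n≡0; m∸n≤m; ∸-monoʳ-<; ∸-monoʳ-≤; +-∸-assoc; m∸[m∸n]≡n
        ; m<n⇒0<n∸m; <ᵇ⇒<; <⇒<ᵇ; ≡⇒≡ᵇ; ≡ᵇ⇒≡ )
open import Data.Product using (_,_; proj₁; proj₂; Σ)
open import Data.Sum using (_⊎_; inj₁; inj₂)
open import Function using (const)
open import Function.Bundles using (Equivalence; mk⇔)
open import Function.Construct.Composition using (_⇔-∘_)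
open import Function.Construct.Symmetry using (⇔-sym)
open import Function.Definitions using (Injective)
open import Relation.Binary.Definitions using (tri<; tri≈; tri>)
open import Relation.Binary.PropositionalEquality
  using (_≢_; refl; sym; trans; cong; cong₂; subst; subst₂; module ≡-Reasoning)
open import Relation.Nullary using (Dec; yes; no)
open import Relation.Nullary.Decidable using (map′; _×-dec_; _→-dec_)

open Equivalence using (to; from)
open ≡-Reasoning

parity : ∀ r → (Even r × -1ℤ ^ r ≡ 1ℤ) ⊎ (Odd r × -1ℤ ^ r ≡ -1ℤ)
parity zero = inj₁ (divides 0 refl , refl)
parity (suc r) with parity r
... | inj₁ (even , sign) = inj₂ (∣m∣n⇒∣m+n ∣-refl even , cong (-1ℤ *_) sign)
... | inj₂ (odd , sign) = inj₁ (odd , cong (-1ℤ *_) sign)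

even⇒¬odd : ∀ {r} → Even r → ¬ Odd r
even⇒¬odd {r} even odd with ∣1⇒≡1 (∣m+n∣m⇒∣n (subst (2 ∣_) (+-comm 1 r) odd) even)
... | ()

true-if : ∀ {b} → T b → b ≡ true
true-if = to T-≡

false-if : ∀ {b} → ¬ T b → b ≡ false
false-if ¬b = ¬-not (λ b≡true → ¬b (from T-≡ b≡true))

sgn-< : ∀ {x y} → x < y → sgnDiff x y ≡ -1ℤ
sgn-< {x} {y} x<y
  rewrite false-if (λ y<ᵇx → <-asym x<y (<ᵇ⇒< y x y<ᵇx)) | true-if (<⇒<ᵇ x<y) = refl

sgn-> : ∀ {x y} → y < x → sgnDiff x y ≡ 1ℤ
sgn-> y<x rewrite true-if (<⇒<ᵇ y<x) = refl

-- sgn(x - y)(-1)^r is 1 when x → y follows the order of a row of index r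
-- (increasing for odd r, decreasing for even r), and -1 otherwise.
signRule : ∀ r {x y} → x ≢ y →
  ((Odd r ⇔ x < y) → sgnDiff x y * -1ℤ ^ r ≡ 1ℤ) ×
  (¬ (Odd r ⇔ x < y) → sgnDiff x y * -1ℤ ^ r ≡ -1ℤ)
signRule r {x} {y} x≢y with parity r | <-cmp x y
... | _ | tri≈ _ x≡y _ = ⊥-elim (x≢y x≡y)
... | inj₁ (even , sign) | tri< x<y _ _ =
  (λ agree → ⊥-elim (even⇒¬odd even (from agree x<y))) , const (cong₂ _*_ (sgn-< x<y) sign)
... | inj₁ (even , sign) | tri> _ _ y<x =
  const (cong₂ _*_ (sgn-> y<x) sign) ,
  (λ disagree → ⊥-elim (disagree (mk⇔ (λ odd → ⊥-elim (even⇒¬odd even odd))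
                                      (λ x<y → ⊥-elim (<-asym x<y y<x)))))
... | inj₂ (odd , sign) | tri< x<y _ _ =
  const (cong₂ _*_ (sgn-< x<y) sign) , (λ disagree → ⊥-elim (disagree (mk⇔ (const x<y) (const odd))))
... | inj₂ (odd , sign) | tri> _ _ y<x =
  (λ agree → ⊥-elim (<-asym (to agree odd) y<x)) , const (cong₂ _*_ (sgn-> y<x) sign)

⇔-cong : ∀ {A A′ B B′ : Set} → A ⇔ A′ → B ⇔ B′ → (A ⇔ B) ⇔ (A′ ⇔ B′)
⇔-cong f g = mk⇔ (λ h → g ⇔-∘ (h ⇔-∘ ⇔-sym f)) (λ h → ⇔-sym g ⇔-∘ (h ⇔-∘ f))

at1-index : ∀ {n} {A : Set} (f : Fin n → A) (d : A) (i : Fin n) → at1 f d (suc (toℕ i)) ≡ f i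
at1-index {n} f d i with toℕ i <? n
... | yes i<n = cong f (fromℕ<-toℕ i i<n)
... | no i≮n = ⊥-elim (i≮n (toℕ<n i))

entry : ∀ {n} → Strip n → Fin n → ℕ
entry H i = suc (toℕ (num H i))

nextEntry : ∀ {n} → Strip n → Fin n → ℕ
nextEntry H i = sigHat H (suc (suc (toℕ i)))

sigHat-entry : ∀ {n} (H : Strip n) (i : Fin n) → sigHat H (suc (toℕ i)) ≡ entry H i
sigHat-entry {n} H i
  rewrite false-if (λ t → <⇒≢ (s<s (toℕ<n i)) (≡ᵇ⇒≡ (suc (toℕ i)) (suc n) t)) =
  at1-index (λ j → entry H j) 0 i

sigHat-last : ∀ {n} (H : Strip n) → sigHat H (suc n) ≡ suc n
sigHat-last {n} H rewrite true-if (≡⇒≡ᵇ n n refl) = refl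

lastOrNext : ∀ {n} (i : Fin n) → suc (toℕ i) ≡ n ⊎ Σ (Fin n) (λ j → toℕ j ≡ suc (toℕ i))
lastOrNext {n} i with suc (toℕ i) <? n
... | yes i+1<n = inj₂ (fromℕ< i+1<n , toℕ-fromℕ< i+1<n)
... | no i+1≮n = inj₁ (≤-antisym (toℕ<n i) (≮⇒≥ i+1≮n))

nextEntry-next : ∀ {n} (H : Strip n) {i j : Fin n} → toℕ j ≡ suc (toℕ i) → nextEntry H i ≡ entry H j
nextEntry-next H {j = j} j≡i+1 = trans (cong (λ c → sigHat H (suc c)) (sym j≡i+1)) (sigHat-entry H j)

nextEntry-last : ∀ {n} (H : Strip n) {i : Fin n} → suc (toℕ i) ≡ n → nextEntry H i ≡ suc n
nextEntry-last H i+1≡n = trans (cong (λ c → sigHat H (suc c)) i+1≡n) (sigHat-last H)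

-- Adjacent entries differ: the numbers are written injectively and all are
-- below the imaginary n+1.
entry≢nextEntry : ∀ {n} (H : Strip n) → Injective _≡_ _≡_ (num H) → ∀ i → entry H i ≢ nextEntry H i
entry≢nextEntry {n} H inj i same with lastOrNext i
... | inj₁ i+1≡n = <-irrefl (trans same (nextEntry-last H i+1≡n)) (s<s (toℕ<n (num H i)))
... | inj₂ (j , j≡i+1) with inj (toℕ-injective (suc-injective (trans same (nextEntry-next H j≡i+1))))
...   | refl = <-irrefl j≡i+1 (n<1+n (toℕ i))

PointsDown : ∀ {n} → Strip n → Fin n → Set
PointsDown H i = Odd (row H i) ⇔ entry H i < nextEntry H i

pointsDown? : ∀ {n} (H : Strip n) (i : Fin n) → Dec (PointsDown H i)
pointsDown? H i =
  map′ (λ (f , g) → mk⇔ f g) (λ e → to e , from e) ((odd? →-dec lt?) ×-dec (lt? →-dec odd?))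
  where
  odd? : Dec (Odd (row H i))
  odd? = 2 ∣? suc (row H i)
  lt? : Dec (entry H i < nextEntry H i)
  lt? = entry H i <? nextEntry H i

epsilon-entries : ∀ {n} (H : Strip n) (i : Fin n) →
  epsilon H i ≡ sgnDiff (entry H i) (nextEntry H i) * -1ℤ ^ row H i
epsilon-entries H i = cong (λ x → sgnDiff x (nextEntry H i) * -1ℤ ^ row H i) (sigHat-entry H i)

-- Pointing down is having assigned direction down; otherwise the assigned
-- direction is up (ε_i ≠ 0 as adjacent entries differ).
pointsDown⇒dirDown : ∀ {n} (H : Strip n) → Injective _≡_ _≡_ (num H) → ∀ i → PointsDown H i → DirDown H i
pointsDown⇒dirDown H inj i pd =
  trans (epsilon-entries H i) (proj₁ (signRule (row H i) (entry≢nextEntry H inj i)) pd)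

¬pointsDown⇒dirUp : ∀ {n} (H : Strip n) → Injective _≡_ _≡_ (num H) → ∀ i → ¬ PointsDown H i → DirUp H i
¬pointsDown⇒dirUp H inj i ¬pd =
  trans (epsilon-entries H i) (proj₂ (signRule (row H i) (entry≢nextEntry H inj i)) ¬pd)

-- In the last column σ_{n+1} = n+1 exceeds σ_n, so σ_n points down iff its
-- row is odd.
pointsDown-last : ∀ {n} (H : Strip n) {i : Fin n} → suc (toℕ i) ≡ n → PointsDown H i ⇔ Odd (row H i)
pointsDown-last H {i} i+1≡n = mk⇔ (λ pd → from pd below) (λ odd → mk⇔ (const below) (const odd))
  where
  below : entry H i < nextEntry H i
  below = subst (entry H i <_) (sym (nextEntry-last H i+1≡n)) (s<s (toℕ<n (num H i)))

RowOrder : ∀ {n} → ℕ → Fin n → Fin n → Set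
RowOrder r x y = (Odd r → toℕ x < toℕ y) × (Even r → toℕ y < toℕ x)

rowOrder-trans : ∀ {n r} {x y z : Fin n} → RowOrder r x y → RowOrder r y z → RowOrder r x z
rowOrder-trans (xy , yx) (yz , zy) = (λ odd → <-trans (xy odd) (yz odd)) , (λ even → <-trans (zy even) (yx even))

pointsDown⇒rowOrder : ∀ {n} (H : Strip n) → Injective _≡_ _≡_ (num H) → {p i : Fin n} →
  toℕ i ≡ suc (toℕ p) → PointsDown H p → RowOrder (row H p) (num H p) (num H i)
pointsDown⇒rowOrder H inj {p} {i} i≡p+1 pd = ascending , descending
  where
  next≡ : nextEntry H p ≡ entry H i
  next≡ = nextEntry-next H i≡p+1
  ascending : Odd (row H p) → toℕ (num H p) < toℕ (num H i)
  ascending odd = s<s⁻¹ (subst (entry H p <_) next≡ (to pd odd))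
  descending : Even (row H p) → toℕ (num H i) < toℕ (num H p)
  descending even = s<s⁻¹ (≤∧≢⇒< (subst (_≤ entry H p) next≡ (≮⇒≥ (λ lt → even⇒¬odd even (from pd lt))))
                                 (λ i≡p → entry≢nextEntry H inj p (trans (sym i≡p) (sym next≡))))

rows-antitone : ∀ {n} {a : Fin n → ℕ} {H : Strip n} → IsH a H →
  (k l : Fin n) → toℕ k ≤ toℕ l → row H l ≤ row H k
rows-antitone hH k l k≤l with m≤n⇒m<n∨m≡n k≤l
... | inj₁ k<l = IsH.horizontal hH k l k<l
... | inj₂ k≡l with toℕ-injective k≡l
...   | refl = ≤-refl

heights-antitone : ∀ {n} (a : Fin n → ℕ) → NonDecreasing a →
  (x y : Fin n) → toℕ x ≤ toℕ y → height a y ≤ height a x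
heights-antitone {n} a nondec x y x≤y = nondec (opposite y) (opposite x)
  (subst₂ _≤_ (sym (opposite-prop y)) (sym (opposite-prop x)) (∸-monoʳ-≤ n (s≤s x≤y)))

moveDown-row : ∀ {n} (H : Strip n) (j k : Fin n) →
  (k ≡ j × row (moveDown H j) k ≡ suc (row H j)) ⊎ (row (moveDown H j) k ≡ row H k)
moveDown-row H j k with k ≟ j
... | yes k≡j = inj₁ (k≡j , refl)
... | no _ = inj₂ refl

LeftClear : ∀ {n} → Strip n → Fin n → Set
LeftClear H j = ∀ k → toℕ k < toℕ j →
  row H j < row H k × (row H k ≡ suc (row H j) → RowOrder (row H k) (num H k) (num H j))

moveDown-valid : ∀ {n} {a : Fin n → ℕ} {H : Strip n} → IsH a H → (j : Fin n) →
  row H j < height a j → LeftClear H j → IsH a (moveDown H j)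
moveDown-valid {a = a} {H} hH j room clear = record
  { inDiagram = inDiagram ; horizontal = horizontal ; bijective = IsH.bijective hH ; proper = proper }
  where
  row′ : Fin _ → ℕ
  row′ = row (moveDown H j)
  inDiagram : ∀ k → 1 ≤ row′ k × row′ k ≤ height a k
  inDiagram k with moveDown-row H j k
  ... | inj₁ (refl , moved) rewrite moved = s≤s z≤n , room
  ... | inj₂ same rewrite same = IsH.inDiagram hH k
  horizontal : ∀ k l → toℕ k < toℕ l → row′ l ≤ row′ k
  horizontal k l k<l with moveDown-row H j k | moveDown-row H j l
  ... | inj₁ (refl , _) | inj₁ (refl , _) = ⊥-elim (<-irrefl refl k<l)
  ... | inj₁ (refl , mk) | inj₂ sl rewrite mk | sl = ≤-trans (IsH.horizontal hH k l k<l) (n≤1+n _)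
  ... | inj₂ sk | inj₁ (refl , ml) rewrite sk | ml = proj₁ (clear k k<l)
  ... | inj₂ sk | inj₂ sl rewrite sk | sl = IsH.horizontal hH k l k<l
  proper : ∀ k l → toℕ k < toℕ l → row′ k ≡ row′ l → RowOrder (row′ k) (num H k) (num H l)
  proper k l k<l eq with moveDown-row H j k | moveDown-row H j l
  ... | inj₁ (refl , _) | inj₁ (refl , _) = ⊥-elim (<-irrefl refl k<l)
  ... | inj₁ (refl , mk) | inj₂ sl =
        ⊥-elim (<-irrefl refl (≤-<-trans (IsH.horizontal hH k l k<l)
                                         (subst (row H k <_) (trans (sym mk) (trans eq sl)) ≤-refl)))
  ... | inj₂ sk | inj₁ (refl , ml) rewrite sk = proj₂ (clear k k<l) (trans eq ml)
  ... | inj₂ sk | inj₂ sl rewrite sk = IsH.proper hH k l k<l (trans eq sl)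

leftClear-first : ∀ {n} (H : Strip n) (i : Fin n) → toℕ i ≡ 0 → LeftClear H i
leftClear-first H i i≡0 k k<i = ⊥-elim (n≮0 (subst (toℕ k <_) i≡0 k<i))

-- When all cells point down, a cell whose left neighbour p lies strictly
-- lower is clear on its left: cells left of p lie no higher than p, and those
-- in p's row precede p, which precedes σ_i.
leftClear-step : ∀ {n} {a : Fin n → ℕ} {H : Strip n} → IsH a H → (∀ i → PointsDown H i) →
  {p i : Fin n} → toℕ i ≡ suc (toℕ p) → row H i < row H p → LeftClear H i
leftClear-step {H = H} hH allDown {p} {i} i≡p+1 i-above-p k k<i = below , ordered
  where
  k≤p : toℕ k ≤ toℕ p
  k≤p = ≤-pred (subst (toℕ k <_) i≡p+1 k<i)
  below : row H i < row H k
  below = <-≤-trans i-above-p (rows-antitone hH k p k≤p)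
  p-before-i : RowOrder (row H p) (num H p) (num H i)
  p-before-i = pointsDown⇒rowOrder H (proj₁ (IsH.bijective hH)) i≡p+1 (allDown p)
  ordered : row H k ≡ suc (row H i) → RowOrder (row H k) (num H k) (num H i)
  ordered k-just-below with m≤n⇒m<n∨m≡n k≤p
  ... | inj₂ k≡p with toℕ-injective k≡p
  ...   | refl = p-before-i
  ordered k-just-below | inj₁ k<p =
    rowOrder-trans (IsH.proper hH k p k<p (sym p≡k)) (subst (λ r → RowOrder r (num H p) (num H i)) p≡k p-before-i)
    where
    p≡k : row H p ≡ row H k
    p≡k = ≤-antisym (rows-antitone hH k p k≤p) (subst (_≤ row H p) (sym k-just-below) i-above-p)

neighbour≤ : ∀ {n} {p i : Fin n} → toℕ i ≡ suc (toℕ p) → toℕ p ≤ toℕ i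
neighbour≤ {p = p} i≡p+1 = subst (toℕ p ≤_) (sym i≡p+1) (n≤1+n (toℕ p))

canMoveDown : ∀ {n} {a : Fin n → ℕ} {H : Strip n} → IsH a H → (∀ i → PointsDown H i) →
  (j : Fin n) → row H j < height a j → LeftClear H j → MoveableDown a H j
canMoveDown {H = H} hH allDown j room clear =
  pointsDown⇒dirDown H (proj₁ (IsH.bijective hH)) j (allDown j) , <⇒≢ room , moveDown-valid hH j room clear

previous : ∀ {n} (i : Fin n) {t} → toℕ i ≡ suc t → Σ (Fin n) (λ p → toℕ i ≡ suc (toℕ p) × toℕ p ≡ t)
previous i {t} i≡t+1 = fromℕ< t<n , trans i≡t+1 (cong suc (sym (toℕ-fromℕ< t<n))) , toℕ-fromℕ< t<n
  where
  t<n : t < _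
  t<n = <-trans (n<1+n t) (subst (_< _) i≡t+1 (toℕ<n i))

-- If all cells point down and σ_i (in column t) has room below it, walking
-- left along σ_i's row reaches a cell that is moveable down.
moveableDown-leftOf : ∀ {n} {a : Fin n → ℕ} {H : Strip n} → IsH a H → NonDecreasing a →
  (∀ i → PointsDown H i) → ∀ t (i : Fin n) → toℕ i ≡ t → row H i < height a i → ∃ (MoveableDown a H)
moveableDown-leftOf {H = H} hH nondec allDown zero i i≡0 room =
  i , canMoveDown hH allDown i room (leftClear-first H i i≡0)
moveableDown-leftOf {a = a} {H} hH nondec allDown (suc t) i i≡t+1 room with previous i i≡t+1
... | p , i≡p+1 , p≡t with row H p N.≟ row H i
...   | yes same = moveableDown-leftOf hH nondec allDown t p p≡t room-at-p
  where
  -- σ_p is in σ_i's row, and column p is at least as tall as column i.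
  room-at-p : row H p < height a p
  room-at-p = subst (_< height a p) (sym same) (<-≤-trans room (heights-antitone a nondec p i (neighbour≤ i≡p+1)))
...   | no differ = i , canMoveDown hH allDown i room (leftClear-step hH allDown i≡p+1 i-above-p)
  where
  i-above-p : row H i < row H p
  i-above-p = ≤∧≢⇒< (rows-antitone hH p i (neighbour≤ i≡p+1)) (λ e → differ (sym e))

Stuck : ∀ {n} → (Fin n → ℕ) → Strip n → Set
Stuck a H = (∀ i → IsBottom a H i) × (∀ i → PointsDown H i)

isBottom? : ∀ {n} (a : Fin n → ℕ) (H : Strip n) (i : Fin n) → Dec (IsBottom a H i)
isBottom? a H i = row H i N.≟ height a i

-- Some cell is moveable, or H is stuck: a cell not pointing down is moveable
-- up, and a non-bottom cell yields one moveable down.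
moveable⊎stuck : ∀ {n} {a : Fin n → ℕ} {H : Strip n} → IsH a H → NonDecreasing a →
  ∃ (Moveable a H) ⊎ Stuck a H
moveable⊎stuck {n} {a} {H} hH nondec with all? (pointsDown? H) | all? (isBottom? a H)
... | no ¬allDown | _ with ¬∀⟶∃¬ n (PointsDown H) (pointsDown? H) ¬allDown
...   | i , ¬pd = inj₁ (i , up (¬pointsDown⇒dirUp H (proj₁ (IsH.bijective hH)) i ¬pd))
moveable⊎stuck hH nondec | yes allDown | yes bottom = inj₂ (bottom , allDown)
moveable⊎stuck {n} {a} {H} hH nondec | yes allDown | no ¬bottom
  with ¬∀⟶∃¬ n (IsBottom a H) (isBottom? a H) ¬bottom
... | i , ¬b with moveableDown-leftOf hH nondec allDown (toℕ i) i refl (≤∧≢⇒< (proj₂ (IsH.inDiagram hH i)) ¬b)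
...   | j , movesDown = inj₁ (j , down movesDown)

stuck⇒unmoveable : ∀ {n} {a : Fin n → ℕ} {H : Strip n} → Injective _≡_ _≡_ (num H) →
  Stuck a H → ¬ ∃ (Moveable a H)
stuck⇒unmoveable {H = H} inj (_ , allDown) (i , up dirUp)
  with trans (sym (pointsDown⇒dirDown H inj i (allDown i))) dirUp
... | ()
stuck⇒unmoveable inj (bottom , _) (i , down (_ , notBottom , _)) = notBottom (bottom i)

unmoveable⇔stuck : ∀ {n} {a : Fin n → ℕ} {H : Strip n} → IsH a H → NonDecreasing a →
  (¬ ∃ (Moveable a H)) ⇔ Stuck a H
unmoveable⇔stuck {a = a} {H} hH nondec = mk⇔ unmoveable⇒stuck (stuck⇒unmoveable (proj₁ (IsH.bijective hH)))
  where
  unmoveable⇒stuck : ¬ ∃ (Moveable a H) → Stuck a H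
  unmoveable⇒stuck unmoveable with moveable⊎stuck hH nondec
  ... | inj₁ moveable = ⊥-elim (unmoveable moveable)
  ... | inj₂ stuck = stuck

height-last : ∀ {m} (a : Fin (suc m) → ℕ) (i : Fin (suc m)) → toℕ i ≡ m → height a i ≡ a zero
height-last {m} a i i≡m = cong a (toℕ-injective (trans (opposite-prop i) (trans (cong (m ∸_) i≡m) (n∸n≡0 m))))

-- In a stuck strip the last cell points down from row a_1, so a_1 is odd.
stuck⇒oddFirst : ∀ {m} {a : Fin (suc m) → ℕ} {H : Strip (suc m)} → Stuck a H → Odd (a zero)
stuck⇒oddFirst {m} {a} {H} (bottom , allDown) =
  subst Odd (trans (bottom last) (height-last a last (toℕ-fromℕ m)))
            (to (pointsDown-last H (cong suc (toℕ-fromℕ m))) (allDown last))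
  where
  last : Fin (suc m)
  last = fromℕ m

-- Column i with right neighbour j sits at position k = m - i of the reversed
-- word σ_n ⋯ σ_1, which reads σ_j at k and σ_i at k+1.
module Position {m} {i j : Fin (suc m)} (j≡i+1 : toℕ j ≡ suc (toℕ i)) where

  i<m : toℕ i < m
  i<m = s<s⁻¹ (subst (_< suc m) j≡i+1 (toℕ<n j))

  m∸[m∸i]≡i : m ∸ (m ∸ toℕ i) ≡ toℕ i
  m∸[m∸i]≡i = m∸[m∸n]≡n (<⇒≤ i<m)

  positive : 1 ≤ m ∸ toℕ i
  positive = m<n⇒0<n∸m i<m

  bounded : m ∸ toℕ i < suc m
  bounded = s≤s (m∸n≤m m (toℕ i))

  revWord-right : (H : Strip (suc m)) → revWord H (m ∸ toℕ i) ≡ entry H j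
  revWord-right H = trans (cong (sigHat H) (begin
      suc (suc m) ∸ (m ∸ toℕ i)     ≡⟨ +-∸-assoc 2 (m∸n≤m m (toℕ i)) ⟩
      suc (suc (m ∸ (m ∸ toℕ i)))   ≡⟨ cong (λ c → suc (suc c)) m∸[m∸i]≡i ⟩
      suc (suc (toℕ i))             ≡⟨ cong suc (sym j≡i+1) ⟩
      suc (toℕ j)                   ∎)) (sigHat-entry H j)

  revWord-left : (H : Strip (suc m)) → revWord H (suc (m ∸ toℕ i)) ≡ entry H i
  revWord-left H = trans (cong (sigHat H) (begin
      suc m ∸ (m ∸ toℕ i)           ≡⟨ +-∸-assoc 1 (m∸n≤m m (toℕ i)) ⟩
      suc (m ∸ (m ∸ toℕ i))         ≡⟨ cong suc m∸[m∸i]≡i ⟩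
      suc (toℕ i)                   ∎)) (sigHat-entry H i)

  at1-height : (a : Fin (suc m) → ℕ) → at1 a 0 (suc (m ∸ toℕ i)) ≡ height a i
  at1-height a = trans (cong (λ c → at1 a 0 (suc c)) (sym (opposite-prop i))) (at1-index a 0 (opposite i))

  descent⇔ascent : (H : Strip (suc m)) →
    DescentSet (suc m) (revWord H) (m ∸ toℕ i) ⇔ entry H i < nextEntry H i
  descent⇔ascent H = mk⇔ (λ (_ , _ , descent) → subst₂ _<_ (revWord-left H) right descent)
                         (λ ascent → positive , bounded , subst₂ _<_ (sym (revWord-left H)) (sym right) ascent)
    where
    right : revWord H (m ∸ toℕ i) ≡ nextEntry H i
    right = trans (revWord-right H) (sym (nextEntry-next H j≡i+1))

  oddSet⇔oddHeight : (a : Fin (suc m) → ℕ) → OddSet a (m ∸ toℕ i) ⇔ Odd (height a i)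
  oddSet⇔oddHeight a = mk⇔ (λ (_ , _ , odd) → subst Odd (at1-height a) odd)
                           (λ odd → positive , bounded , subst Odd (sym (at1-height a)) odd)

atPosition : ∀ {m} (P : ℕ → Set) {k} → 1 ≤ k → k < suc m →
  (∀ {i j : Fin (suc m)} → toℕ j ≡ suc (toℕ i) → P (m ∸ toℕ i)) → P k
atPosition {m} P {k} 1≤k k<1+m atColumn = subst P m∸i≡k (atColumn j≡i+1)
  where
  k≤m : k ≤ m
  k≤m = ≤-pred k<1+m
  m∸k<m : m ∸ k < m
  m∸k<m = ∸-monoʳ-< 1≤k k≤m
  i j : Fin (suc m)
  m∸k<1+m : m ∸ k < suc m
  m∸k<1+m = <-trans m∸k<m (n<1+n m)
  i = fromℕ< m∸k<1+m
  j = fromℕ< (s<s m∸k<m)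
  j≡i+1 : toℕ j ≡ suc (toℕ i)
  j≡i+1 = trans (toℕ-fromℕ< (s<s m∸k<m)) (cong suc (sym (toℕ-fromℕ< m∸k<1+m)))
  m∸i≡k : m ∸ toℕ i ≡ k
  m∸i≡k = trans (cong (m ∸_) (toℕ-fromℕ< m∸k<1+m)) (m∸[m∸n]≡n k≤m)

pointsDown⇔descentRule : ∀ {m} {a : Fin (suc m) → ℕ} {H : Strip (suc m)} → (∀ i → IsBottom a H i) →
  {i j : Fin (suc m)} → toℕ j ≡ suc (toℕ i) →
  PointsDown H i ⇔ (OddSet a (m ∸ toℕ i) ⇔ DescentSet (suc m) (revWord H) (m ∸ toℕ i))
pointsDown⇔descentRule {a = a} {H} bottom {i} j≡i+1 =
  ⇔-cong (⇔-sym (oddSet⇔oddHeight a) ⇔-∘ oddRow⇔oddHeight) (⇔-sym (descent⇔ascent H))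
  where
  open Position j≡i+1
  oddRow⇔oddHeight : Odd (row H i) ⇔ Odd (height a i)
  oddRow⇔oddHeight = mk⇔ (subst Odd (bottom i)) (subst Odd (sym (bottom i)))

allDown⇔descents : ∀ {m} {a : Fin (suc m) → ℕ} {H : Strip (suc m)} → Odd (a zero) →
  (∀ i → IsBottom a H i) →
  (∀ i → PointsDown H i) ⇔ (∀ k → DescentSet (suc m) (revWord H) k ⇔ OddSet a k)
allDown⇔descents {m} {a} {H} oddFirst bottom = mk⇔ descents allDown
  where
  rule : ∀ {i j : Fin (suc m)} → toℕ j ≡ suc (toℕ i) →
    PointsDown H i ⇔ (OddSet a (m ∸ toℕ i) ⇔ DescentSet (suc m) (revWord H) (m ∸ toℕ i))
  rule = pointsDown⇔descentRule bottom
  descents : (∀ i → PointsDown H i) → ∀ k → DescentSet (suc m) (revWord H) k ⇔ OddSet a k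
  descents allPD k = mk⇔
    (λ d → atPosition (λ k → DescentSet (suc m) (revWord H) k → OddSet a k) (proj₁ d) (proj₁ (proj₂ d))
             (λ {i} j≡i+1 → from (to (rule j≡i+1) (allPD i))) d)
    (λ o → atPosition (λ k → OddSet a k → DescentSet (suc m) (revWord H) k) (proj₁ o) (proj₁ (proj₂ o))
             (λ {i} j≡i+1 → to (to (rule j≡i+1) (allPD i))) o)
  allDown : (∀ k → DescentSet (suc m) (revWord H) k ⇔ OddSet a k) → ∀ i → PointsDown H i
  allDown rightDescents i with lastOrNext i
  ... | inj₁ i+1≡1+m = from (pointsDown-last H i+1≡1+m)
                            (subst Odd (sym (trans (bottom i) (height-last a i (suc-injective i+1≡1+m)))) oddFirst)
  ... | inj₂ (j , j≡i+1) = from (rule j≡i+1) (⇔-sym (rightDescents (m ∸ toℕ i)))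

stuck⇔descents : ∀ {m} {a : Fin (suc m) → ℕ} {H : Strip (suc m)} → Odd (a zero) →
  Stuck a H ⇔ ((∀ i → IsBottom a H i) × (∀ k → DescentSet (suc m) (revWord H) k ⇔ OddSet a k))
stuck⇔descents oddFirst =
  mk⇔ (λ (bottom , allPD) → bottom , to (allDown⇔descents oddFirst bottom) allPD)
      (λ (bottom , descents) → bottom , from (allDown⇔descents oddFirst bottom) descents)

lemma2p3 : ∀ (m : ℕ) (a : Fin (suc m) → ℕ) → NonDecreasing a → (∀ i → 1 ≤ a i) →
    (Even (a zero) → ∀ (H : Strip (suc m)) → IsH a H → ∃ (λ i → Moveable a H i)) ×
    (Odd (a zero) → ∀ (H : Strip (suc m)) → IsH a H →
      ((¬ ∃ (λ i → Moveable a H i)) ⇔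
        ((∀ i → IsBottom a H i) × (∀ k → DescentSet (suc m) (revWord H) k ⇔ OddSet a k))))
lemma2p3 m a nondec _ = evenCase , oddCase
  where
  -- A stuck strip would make a_1 odd.
  evenCase : Even (a zero) → ∀ (H : Strip (suc m)) → IsH a H → ∃ (λ i → Moveable a H i)
  evenCase even H hH with moveable⊎stuck hH nondec
  ... | inj₁ moveable = moveable
  ... | inj₂ stuck = ⊥-elim (even⇒¬odd even (stuck⇒oddFirst {a = a} stuck))

  oddCase : Odd (a zero) → ∀ (H : Strip (suc m)) → IsH a H →
    ((¬ ∃ (λ i → Moveable a H i)) ⇔
      ((∀ i → IsBottom a H i) × (∀ k → DescentSet (suc m) (revWord H) k ⇔ OddSet a k)))
  oddCase odd H hH = stuck⇔descents odd ⇔-∘ unmoveable⇔stuck hH nondec
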